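{- Let $N\ge4$. Then for every $J\subseteq[N]^2$, \[\mathrm{rank}\,(C^{\mathrm{magic}}_N)_J\ \ge\ \begin{cases}\min\left\{\lceil 2\sqrt{|J|}\rceil-1,\ 2N-2\right\}+E_N(J) & \text{if } |J|\ne (N-1)^2+1,\\ 2N-3+E_N(J) & \text{if } |J|=(N-1)^2+1.\end{cases}\]
   Context: $[n]=\{1,\dots,n\}$. Let ${\bf 1}_N$ be the all-ones vector in $\mathbb{R}^N$, ${\bf 0}_N$ the zero vector, and ${\mathbf e}_N(m)$ the $m$-th standard basis vector of $\mathbb{R}^N$. Let $D_1(N)=\{(i,j)\in[N]^2:i=j\}$ and $D_2(N)=\{(i,j)\in[N]^2:i+j=N+1\}$. For $(i,j)\in[N]^2$ define the vector ${\mathbf d}_{i,j}\in\mathbb{Z}^{2N}$ (written as a pair of $N$-vectors, top then bottom) by: ${\mathbf d}_{i,j}=({\mathbf e}_N(i)-{\bf 1}_N,\ {\mathbf e}_N(j)-{\bf 1}_N)$ if $(i,j)\in D_1(N)\cap D_2(N)$; $({\mathbf e}_N(i)-{\bf 1}_N,\ {\mathbf e}_N(j))$ if $(i,j)\in D_1(N)\setminus D_2(N)$; $({\mathbf e}_N(i),\ {\mathbf e}_N(j)-{\bf 1}_N)$ if $(i,j)\in D_2(N)\setminus D_1(N)$; and $({\mathbf e}_N(i),\ {\mathbf e}_N(j))$ otherwise. For $J\subseteq[N]^2$, $(C^{\mathrm{magic}}_N)_J$ is the $2N\times|J|$ matrix whose columns are ${\mathbf d}_{i,j}$, $(i,j)\in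 J$ (in any order). Let $E_N(J)=\dim\big(\mathrm{im}\,(C^{\mathrm{magic}}_N)_J\cap \mathrm{span}\{({\bf 1}_N,{\bf 0}_N),({\bf 0}_N,{\bf 1}_N)\}\big)$, where $\mathrm{im}$ denotes column space. -}

module Defs where

open import Data.Nat as ℕ using (ℕ; zero; suc; _≤?_)
open import Data.Fin using (Fin; toℕ)
open import Data.Fin.Properties using () renaming (_≟_ to _≟ᶠ_)
open import Data.Sum using (_⊎_; inj₁; inj₂)
open import Data.Product using (_×_; _,_; Σ; ∃)
open import Data.List using (List; []; _∷_; length; map)
open import Data.List.Relation.Unary.All using (All)
open import Data.Rational using (ℚ; 0ℚ; 1ℚ; _+_; _*_; _-_)
open import Relation.Binary.PropositionalEquality using (_≡_)
open import Relation.Nullary using (¬_; yes; no)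

-- Vectors in ℚ^{2N}, written as a pair (top, bottom) of N-vectors:
-- v (inj₁ i) is the i-th top coordinate, v (inj₂ i) the i-th bottom one.
V : ℕ → Set
V N = Fin N ⊎ Fin N → ℚ

_≈v_ : ∀ {N} → V N → V N → Set
u ≈v v = ∀ x → u x ≡ v x

0v : ∀ {N} → V N
0v _ = 0ℚ

_+v_ : ∀ {N} → V N → V N → V N
(u +v v) x = u x + v x

_•_ : ∀ {N} → ℚ → V N → V N
(a • v) x = a * v x

lincomb : ∀ {N} (vs : List (V N)) → (Fin (length vs) → ℚ) → V N
lincomb [] c = 0v
lincomb (v ∷ vs) c = (c Fin.zero • v) +v lincomb vs (λ k → c (Fin.suc k))


Independent : ∀ {N} → List (V N) → Set
Independent vs = ∀ c → lincomb vs c ≈v 0v → ∀ k → c k ≡ 0ℚ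

HasDim : ∀ {N} → (V N → Set) → ℕ → Set
HasDim {N} W d =
  (Σ (List (V N)) λ vs → length vs ≡ d × All W vs × Independent vs) ×
  (∀ (vs : List (V N)) → All W vs → length vs ≡ suc d → ¬ Independent vs)

-- indicator helpers (indices are 0-based Fin; i ↦ i+1 in the paper)
δ : ∀ {N} → Fin N → Fin N → ℚ
δ i k with i ≟ᶠ k
... | yes _ = 1ℚ
... | no  _ = 0ℚ

inD1 : ∀ {N} → Fin N → Fin N → ℚ
inD1 i j = δ i j

-- (i,j) ∈ D₂(N) : i + j = N + 1 (1-based), i.e. toℕ i + toℕ j + 1 = N
inD2 : ∀ {N} → Fin N → Fin N → ℚ
inD2 {N} i j with suc (toℕ i ℕ.+ toℕ j) ℕ.≟ N
... | yes _ = 1ℚ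
... | no  _ = 0ℚ

dvec : ∀ {N} → Fin N × Fin N → V N
dvec (i , j) (inj₁ k) = δ i k - inD1 i j
dvec (i , j) (inj₂ k) = δ j k - inD2 i j

-- column space of (C^magic_N)_J, J given as a duplicate-free list of index pairs
ColSpace : ∀ {N} → List (Fin N × Fin N) → V N → Set
ColSpace J v = ∃ λ c → lincomb (map dvec J) c ≈v v

oneTop oneBot : ∀ {N} → V N
oneTop (inj₁ _) = 1ℚ
oneTop (inj₂ _) = 0ℚ
oneBot (inj₁ _) = 0ℚ
oneBot (inj₂ _) = 1ℚ

Span2 : ∀ {N} → V N → Set
Span2 {N} v = ∃ λ c → lincomb (oneTop {N} ∷ oneBot ∷ []) c ≈v v

EInter : ∀ {N} → List (Fin N × Fin N) → V N → Set
EInter J v = ColSpace J v × Span2 v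

-- ⌈√n⌉ : least k with n ≤ k*k (search from 0; k = n always works)
ceilSqrtFrom : ℕ → ℕ → ℕ → ℕ
ceilSqrtFrom zero k n = k
ceilSqrtFrom (suc f) k n with n ≤? k ℕ.* k
... | yes _ = k
... | no  _ = ceilSqrtFrom f (suc k) n

ceilSqrt : ℕ → ℕ
ceilSqrt n = ceilSqrtFrom (suc n) 0 n

-- ⌈2√m⌉ = ⌈√(4m)⌉
ceil2Sqrt : ℕ → ℕ
ceil2Sqrt m = ceilSqrt (4 ℕ.* m)

{-# OPTIONS --safe #-}
module Submission where

-- View J as a bipartite graph between rows and columns. Each column d_{i,j} of C^magic_N
-- differs from the incidence vector (e_i, e_j) by a vector of the plane
-- S = span{(1_N, 0_N), (0_N, 1_N)}. If F ⊆ J is a forest missing some row or column, no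
-- nontrivial combination of the incidence vectors of F lies in S: such a combination has
-- equal top and bottom coordinate sums, so it would be a multiple of (1_N, 1_N) vanishing on
-- the missed line, i.e. zero, while the incidence vectors of a forest are independent. Hence
-- the d_{i,j} with (i,j) ∈ F together with a basis of im ∩ S are independent, and the rank
-- is at least |F| + E_N(J).
--
-- The forests are brooms: all of a row i₀ of maximal degree d, plus one entry in each of R
-- other rows, so that |J| ≤ (R + 1) d and, by AM-GM, 4 |J| ≤ (R + d + 1)². An empty row is a
-- missed line. If all rows are occupied, a broom through all of them avoids a column outside
-- row i₀ unless that column is the only column of another row. Otherwise one row is dropped:
-- if row i₀ is full, 2N - 2 edges remain; else the dropped row has a single entry, so
-- |J| ≤ 1 + d (N - 1), which suffices except at |J| = (N - 1)² + 1 (for d = N - 2 a second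
-- such row is needed).

module ListCounting where

  open import Data.Nat using (ℕ; suc; _+_; _*_; _≤_; _<_; z≤n; s≤s)
  open import Data.Nat.Properties as ℕ using (+-mono-≤; module ≤-Reasoning) renaming (_≟_ to _≟ℕ_)
  open import Algebra.Properties.CommutativeSemigroup ℕ.+-commutativeSemigroup using (x∙yz≈y∙xz)
  open import Data.Nat.ListAction using (sum)
  open import Data.List using (List; []; _∷_; length; map; filter; concatMap)
  open import Data.List.Properties using (filter-notAll; filter-accept; filter-reject; filter-all; length-++)
  open import Data.List.Relation.Unary.All as All using (All; []; _∷_)
  open import Data.List.Relation.Unary.Any as Any using (here; there)
  open import Data.List.Membership.Propositional using (_∈_)
  open import Data.List.Membership.Propositional.Properties using (∈-filter⁺; ∈-filter⁻)
  open import Data.List.Relation.Binary.Subset.Propositional using (_⊆_)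
  open import Data.List.Relation.Unary.Unique.Propositional using (Unique; []; _∷_)
  import Data.List.Relation.Unary.Unique.Propositional.Properties as Unique
  open import Data.Product using (_×_)
  open import Function using (_∘_)
  open import Relation.Binary.Definitions using (DecidableEquality)
  open import Relation.Binary.PropositionalEquality using (_≡_; _≢_; refl; sym; trans; cong; ≢-sym; module ≡-Reasoning)
  open import Relation.Nullary using (Dec; ¬?; yes; no)

  firstOr : {A : Set} → A → List A → A
  firstOr d []      = d
  firstOr _ (x ∷ _) = x

  firstOr-∈ : ∀ {A : Set} (d : A) {xs} → 0 < length xs → firstOr d xs ∈ xs
  firstOr-∈ d {_ ∷ _} _ = here refl

  length-concatMap : ∀ {A B : Set} (f : A → List B) xs → length (concatMap f xs) ≡ sum (map (length ∘ f) xs)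
  length-concatMap f []       = refl
  length-concatMap f (x ∷ xs) = trans (length-++ (f x)) (cong (length (f x) +_) (length-concatMap f xs))

  module _ {A : Set} (_≟_ : DecidableEquality A) where

    _≢?_ : ∀ y x → Dec (y ≢ x)
    y ≢? x = ¬? (y ≟ x)

    without : A → List A → List A
    without x = filter (_≢? x)

    ∈-without⁺ : ∀ {x y xs} → y ∈ xs → y ≢ x → y ∈ without x xs
    ∈-without⁺ {x} = ∈-filter⁺ (_≢? x)

    ∈-without⁻ : ∀ {x y} xs → y ∈ without x xs → y ∈ xs × y ≢ x
    ∈-without⁻ {x} xs = ∈-filter⁻ (_≢? x) {xs = xs}

    without-unique : ∀ x {xs} → Unique xs → Unique (without x xs)
    without-unique x = Unique.filter⁺ (_≢? x)

    Unique⇒length-≤ : ∀ {xs ys} → Unique xs → xs ⊆ ys → length xs ≤ length ys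
    Unique⇒length-≤ {[]}     _            _    = z≤n
    Unique⇒length-≤ {x ∷ xs} {ys} (x∉xs ∷ u) x∷xs⊆ys = begin
      suc (length xs)              ≤⟨ s≤s (Unique⇒length-≤ u xs⊆ys-x) ⟩
      suc (length (without x ys))  ≤⟨ filter-notAll (_≢? x) ys (Any.map (λ x≡y y≢x → y≢x (sym x≡y)) x∈ys) ⟩
      length ys                    ∎
      where
      open ≤-Reasoning
      x∈ys : x ∈ ys
      x∈ys = x∷xs⊆ys (here refl)
      xs⊆ys-x : xs ⊆ without x ys
      xs⊆ys-x y∈xs = ∈-without⁺ (x∷xs⊆ys (there y∈xs)) (λ y≡x → All.lookup x∉xs y∈xs (sym y≡x))

    sum-map-without : ∀ (f : A → ℕ) {x xs} → Unique xs → x ∈ xs →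
                      sum (map f xs) ≡ f x + sum (map f (without x xs))
    sum-map-without f {x} {.x ∷ ys} (x∉ys ∷ _) (here refl) =
      cong (λ zs → f x + sum (map f zs)) (sym (begin
        without x (x ∷ ys)  ≡⟨ filter-reject (_≢? x) (λ x≢x → x≢x refl) ⟩
        without x ys        ≡⟨ filter-all (_≢? x) (All.map ≢-sym x∉ys) ⟩
        ys                  ∎))
      where open ≡-Reasoning
    sum-map-without f {x} {y ∷ ys} (y∉ys ∷ u) (there x∈ys) = begin
      f y + sum (map f ys)                      ≡⟨ cong (f y +_) (sum-map-without f u x∈ys) ⟩
      f y + (f x + sum (map f (without x ys)))  ≡⟨ x∙yz≈y∙xz (f y) (f x) _ ⟩
      f x + sum (map f (y ∷ without x ys))      ≡⟨ cong (λ zs → f x + sum (map f zs)) (sym without-y∷ys) ⟩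
      f x + sum (map f (without x (y ∷ ys)))    ∎
      where
      open ≡-Reasoning
      without-y∷ys : without x (y ∷ ys) ≡ y ∷ without x ys
      without-y∷ys = filter-accept (_≢? x) (All.lookup y∉ys x∈ys)

    length-without : ∀ {x xs} → Unique xs → x ∈ xs → length xs ≡ suc (length (without x xs))
    length-without {x} {xs} u x∈xs = begin
      length xs                                 ≡⟨ sym (sum-map-const xs) ⟩
      sum (map (λ _ → 1) xs)                    ≡⟨ sum-map-without (λ _ → 1) u x∈xs ⟩
      suc (sum (map (λ _ → 1) (without x xs)))  ≡⟨ cong suc (sum-map-const (without x xs)) ⟩
      suc (length (without x xs))               ∎
      where
      open ≡-Reasoning
      sum-map-const : ∀ ys → sum (map (λ _ → 1) ys) ≡ length ys
      sum-map-const []       = refl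
      sum-map-const (_ ∷ ys) = cong suc (sum-map-const ys)

  module _ {A : Set} (f : A → ℕ) where

    sum-map-≤ : ∀ {a xs} → All (λ x → f x ≤ a) xs → sum (map f xs) ≤ length xs * a
    sum-map-≤ []         = z≤n
    sum-map-≤ (fx≤a ∷ h) = +-mono-≤ fx≤a (sum-map-≤ h)

    nonzero? : ∀ x → Dec (f x ≢ 0)
    nonzero? x = ¬? (f x ≟ℕ 0)

    support : List A → List A
    support = filter nonzero?

    sum-map-support : ∀ xs → sum (map f (support xs)) ≡ sum (map f xs)
    sum-map-support []       = refl
    sum-map-support (x ∷ xs) with f x ≟ℕ 0
    ... | yes fx≡0 = begin
      sum (map f (support (x ∷ xs)))  ≡⟨ cong (sum ∘ map f) (filter-reject nonzero? (λ fx≢0 → fx≢0 fx≡0)) ⟩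
      sum (map f (support xs))        ≡⟨ sum-map-support xs ⟩
      sum (map f xs)                  ≡⟨ cong (_+ sum (map f xs)) (sym fx≡0) ⟩
      f x + sum (map f xs)            ∎
      where open ≡-Reasoning
    ... | no fx≢0 = begin
      sum (map f (support (x ∷ xs)))  ≡⟨ cong (sum ∘ map f) (filter-accept nonzero? fx≢0) ⟩
      f x + sum (map f (support xs))  ≡⟨ cong (f x +_) (sum-map-support xs) ⟩
      f x + sum (map f xs)            ∎
      where open ≡-Reasoning

module LinearAlgebra where

  open import Defs
  open import Algebra.Bundles using (CommutativeRing)
  open import Data.Nat as ℕ using (ℕ; zero; suc)
  import Data.Nat.Properties as ℕ
  open import Data.Fin using (Fin; zero; suc)
  open import Data.Rational using (ℚ; 0ℚ; 1ℚ; _+_; _*_; _-_; -_; _≤_; _<_)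
  open import Data.Rational.Properties using (+-*-commutativeRing; <-cmp; <⇒≢; <⇒≤; ≤-refl; +-mono-≤; +-mono-<-≤)
  open import Data.Rational.Solver using (module +-*-Solver)
  open import Data.List using (List; []; _∷_; length; drop; _++_)
  open import Data.List.Properties using (length-drop)
  open import Data.List.Relation.Unary.All as All using (All; []; _∷_)
  import Data.List.Relation.Unary.All.Properties as All
  open import Data.Product using (_×_; _,_; ∃; ∃₂)
  open import Data.Unit using (⊤)
  open import Function using (_∘_)
  open import Relation.Binary.Definitions using (tri<; tri≈; tri>)
  open import Relation.Binary.PropositionalEquality using (_≡_; refl; sym; trans; cong; cong₂; module ≡-Reasoning)
  open import Relation.Nullary using (yes; no; contradiction)
  open import Algebra.Properties.Semiring.Sum (CommutativeRing.semiring +-*-commutativeRing)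
    using (sum; sum-syntax; ∑-distrib-+; *-distribˡ-sum)
  open +-*-Solver

  ∑-linear : ∀ n a (f g : Fin n → ℚ) → ∑[ k < n ] (a * f k + g k) ≡ a * ∑[ k < n ] f k + ∑[ k < n ] g k
  ∑-linear n a f g = trans (∑-distrib-+ (λ k → a * f k) g) (cong (_+ sum g) (sym (*-distribˡ-sum a f)))

  ∑-const-mono-≤ : ∀ n {a b} → a ≤ b → ∑[ k < n ] a ≤ ∑[ k < n ] b
  ∑-const-mono-≤ zero    _   = ≤-refl
  ∑-const-mono-≤ (suc n) a≤b = +-mono-≤ a≤b (∑-const-mono-≤ n a≤b)

  ∑-const-mono-< : ∀ n {a b} → a < b → ∑[ k < suc n ] a < ∑[ k < suc n ] b
  ∑-const-mono-< n a<b = +-mono-<-≤ a<b (∑-const-mono-≤ n (<⇒≤ a<b))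

  ∑-const-injective : ∀ n {a b} → ∑[ k < suc n ] a ≡ ∑[ k < suc n ] b → a ≡ b
  ∑-const-injective n {a} {b} eq with <-cmp a b
  ... | tri< a<b _ _ = contradiction eq (<⇒≢ (∑-const-mono-< n a<b))
  ... | tri≈ _ a≡b _ = a≡b
  ... | tri> _ _ b<a = contradiction (sym eq) (<⇒≢ (∑-const-mono-< n b<a))

  module _ {N : ℕ} where

    lincomb-vanishes-at : ∀ (vs : List (V N)) c x → All (λ w → w x ≡ 0ℚ) vs → lincomb vs c x ≡ 0ℚ
    lincomb-vanishes-at []       c x []         = refl
    lincomb-vanishes-at (v ∷ vs) c x (vx≡0 ∷ h) rewrite vx≡0 | lincomb-vanishes-at vs (c ∘ suc) x h =
      solve 1 (λ a → a :* con 0ℚ :+ con 0ℚ := con 0ℚ) refl (c zero)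

    lincomb-zero-coeffs : ∀ (vs : List (V N)) {c} → (∀ k → c k ≡ 0ℚ) → lincomb vs c ≈v 0v
    lincomb-zero-coeffs []       c≡0 x = refl
    lincomb-zero-coeffs (v ∷ vs) c≡0 x rewrite c≡0 zero | lincomb-zero-coeffs vs (c≡0 ∘ suc) x =
      solve 1 (λ a → con 0ℚ :* a :+ con 0ℚ := con 0ℚ) refl (v x)

    independent-∷⁻ : ∀ {v} {vs : List (V N)} → Independent (v ∷ vs) → Independent vs
    independent-∷⁻ {v} {vs} ind c vs·c≈0 k = ind c′ v∷vs·c′≈0 (suc k)
      where
      c′ : Fin (suc (length vs)) → ℚ
      c′ zero    = 0ℚ
      c′ (suc k) = c k
      v∷vs·c′≈0 : lincomb (v ∷ vs) c′ ≈v 0v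
      v∷vs·c′≈0 x rewrite vs·c≈0 x = solve 1 (λ a → con 0ℚ :* a :+ con 0ℚ := con 0ℚ) refl (v x)

    independent-drop : ∀ k {vs : List (V N)} → Independent vs → Independent (drop k vs)
    independent-drop zero    ind = ind
    independent-drop (suc k) {[]}    ind = ind
    independent-drop (suc k) {v ∷ vs} ind = independent-drop k (independent-∷⁻ {v} {vs} ind)

    independent⇒length≤dim : ∀ {W : V N → Set} {r vs} → HasDim W r → All W vs → Independent vs → length vs ℕ.≤ r
    independent⇒length≤dim {r = r} {vs} (_ , no-larger) Wvs ind with length vs ℕ.≤? r
    ... | yes ≤r = ≤r
    ... | no ≰r  = contradiction (independent-drop k ind) (no-larger (drop k vs) (All.drop⁺ k Wvs) length-suffix)
      where
      k = length vs ℕ.∸ suc r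
      length-suffix : length (drop k vs) ≡ suc r
      length-suffix = trans (length-drop k vs) (ℕ.m∸[m∸n]≡n (ℕ.≰⇒> ≰r))

    Echelon : List (V N) → Set
    Echelon []       = ⊤
    Echelon (v ∷ vs) = (∃ λ x → v x ≡ 1ℚ × All (λ w → w x ≡ 0ℚ) vs) × Echelon vs

    echelon⇒independent : ∀ {vs} → Echelon vs → Independent vs
    echelon⇒independent {v ∷ vs} ((x , vx≡1 , vs-x≡0) , ech) c v∷vs·c≈0 = coeffs≡0
      where
      c₀≡0 : c zero ≡ 0ℚ
      c₀≡0 = begin
        c zero                                   ≡⟨ solve 1 (λ a → a := a :* con 1ℚ :+ con 0ℚ) refl (c zero) ⟩
        c zero * 1ℚ + 0ℚ                         ≡⟨ cong₂ (λ a b → c zero * a + b) (sym vx≡1) (sym vs·c-x≡0) ⟩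
        c zero * v x + lincomb vs (c ∘ suc) x    ≡⟨ v∷vs·c≈0 x ⟩
        0ℚ                                       ∎
        where
        open ≡-Reasoning
        vs·c-x≡0 : lincomb vs (c ∘ suc) x ≡ 0ℚ
        vs·c-x≡0 = lincomb-vanishes-at vs (c ∘ suc) x vs-x≡0
      vs·c≈0 : lincomb vs (c ∘ suc) ≈v 0v
      vs·c≈0 y = begin
        lincomb vs (c ∘ suc) y                  ≡⟨ solve 2 (λ a b → b := con 0ℚ :* a :+ b) refl (v y) (lincomb vs (c ∘ suc) y) ⟩
        0ℚ * v y + lincomb vs (c ∘ suc) y       ≡⟨ cong (λ a → a * v y + lincomb vs (c ∘ suc) y) (sym c₀≡0) ⟩
        c zero * v y + lincomb vs (c ∘ suc) y   ≡⟨ v∷vs·c≈0 y ⟩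
        0ℚ                                      ∎
        where open ≡-Reasoning
      coeffs≡0 : ∀ k → c k ≡ 0ℚ
      coeffs≡0 zero    = c₀≡0
      coeffs≡0 (suc k) = echelon⇒independent ech (c ∘ suc) vs·c≈0 k

    plane : ℚ → ℚ → V N
    plane α β = (α • oneTop) +v (β • oneBot)

    InPlane : V N → Set
    InPlane v = ∃₂ λ α β → v ≈v plane α β

    span2⇒inPlane : ∀ {v} → Span2 v → InPlane v
    span2⇒inPlane {v} (c , h) = c zero , c (suc zero) , λ x → trans (sym (h x))
      (solve 4 (λ a t b u → a :* t :+ (b :* u :+ con 0ℚ) := a :* t :+ b :* u)
             refl (c zero) (oneTop x) (c (suc zero)) (oneBot x))

    lincomb-inPlane : ∀ {us} → All InPlane us → ∀ c → InPlane (lincomb us c)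
    lincomb-inPlane [] c = 0ℚ , 0ℚ , λ x →
      solve 2 (λ t u → con 0ℚ := con 0ℚ :* t :+ con 0ℚ :* u) refl (oneTop x) (oneBot x)
    lincomb-inPlane {u ∷ us} ((α , β , u≈) ∷ us-plane) c with lincomb-inPlane us-plane (c ∘ suc)
    ... | α′ , β′ , rest≈ = c zero * α + α′ , c zero * β + β′ , λ x → begin
      c zero * u x + lincomb us (c ∘ suc) x
        ≡⟨ cong₂ (λ a b → c zero * a + b) (u≈ x) (rest≈ x) ⟩
      c zero * (α * oneTop x + β * oneBot x) + (α′ * oneTop x + β′ * oneBot x)
        ≡⟨ solve 7 (λ c₀ a b a′ b′ t w → c₀ :* (a :* t :+ b :* w) :+ (a′ :* t :+ b′ :* w)
                                          := (c₀ :* a :+ a′) :* t :+ (c₀ :* b :+ b′) :* w)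
                 refl (c zero) α β α′ β′ (oneTop x) (oneBot x) ⟩
      (c zero * α + α′) * oneTop x + (c zero * β + β′) * oneBot x
        ∎
      where open ≡-Reasoning

    coeffsˡ : ∀ (xs : List (V N)) {ys} → (Fin (length (xs ++ ys)) → ℚ) → Fin (length xs) → ℚ
    coeffsˡ (_ ∷ xs) c zero    = c zero
    coeffsˡ (_ ∷ xs) c (suc k) = coeffsˡ xs (c ∘ suc) k

    coeffsʳ : ∀ (xs : List (V N)) {ys} → (Fin (length (xs ++ ys)) → ℚ) → Fin (length ys) → ℚ
    coeffsʳ []       c = c
    coeffsʳ (_ ∷ xs) c = coeffsʳ xs (c ∘ suc)

    lincomb-++ : ∀ xs {ys} c x → lincomb (xs ++ ys) c x ≡ lincomb xs (coeffsˡ xs c) x + lincomb ys (coeffsʳ xs c) x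
    lincomb-++ []       {ys} c x = solve 1 (λ a → a := con 0ℚ :+ a) refl (lincomb ys c x)
    lincomb-++ (v ∷ xs) {ys} c x rewrite lincomb-++ xs (c ∘ suc) x =
      solve 3 (λ a b d → a :+ (b :+ d) := (a :+ b) :+ d) refl
        (c zero * v x) (lincomb xs (coeffsˡ xs (c ∘ suc)) x) (lincomb ys (coeffsʳ xs (c ∘ suc)) x)

    coeffs-++-zero : ∀ xs {ys} c → (∀ k → coeffsˡ xs c k ≡ 0ℚ) → (∀ k → coeffsʳ xs {ys} c k ≡ 0ℚ) →
                     ∀ k → c k ≡ 0ℚ
    coeffs-++-zero []       c _   c₂≡0 k       = c₂≡0 k
    coeffs-++-zero (_ ∷ xs) c c₁≡0 _   zero    = c₁≡0 zero
    coeffs-++-zero (_ ∷ xs) c c₁≡0 c₂≡0 (suc k) = coeffs-++-zero xs (c ∘ suc) (c₁≡0 ∘ suc) c₂≡0 k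

    IndependentModPlane : List (V N) → Set
    IndependentModPlane vs = ∀ c → InPlane (lincomb vs c) → ∀ k → c k ≡ 0ℚ

    ++-independent : ∀ xs {ys} → IndependentModPlane xs → All InPlane ys → Independent ys → Independent (xs ++ ys)
    ++-independent xs {ys} xs-ind ys-plane ys-ind c xs++ys·c≈0 = coeffs-++-zero xs c c₁≡0 c₂≡0
      where
      c₁ = coeffsˡ xs c
      c₂ = coeffsʳ xs c
      split : ∀ x → lincomb xs c₁ x + lincomb ys c₂ x ≡ 0ℚ
      split x = trans (sym (lincomb-++ xs c x)) (xs++ys·c≈0 x)
      c₁≡0 : ∀ k → c₁ k ≡ 0ℚ
      c₁≡0 with lincomb-inPlane ys-plane c₂
      ... | α , β , ys-part≈ = xs-ind c₁ (- α , - β , λ x → begin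
        lincomb xs c₁ x
          ≡⟨ solve 2 (λ a b → a := (a :+ b) :- b) refl (lincomb xs c₁ x) (lincomb ys c₂ x) ⟩
        (lincomb xs c₁ x + lincomb ys c₂ x) - lincomb ys c₂ x
          ≡⟨ cong₂ _-_ (split x) (ys-part≈ x) ⟩
        0ℚ - (α * oneTop x + β * oneBot x)
          ≡⟨ solve 4 (λ a b t w → con 0ℚ :- (a :* t :+ b :* w) := (:- a) :* t :+ (:- b) :* w)
                   refl α β (oneTop x) (oneBot x) ⟩
        (- α) * oneTop x + (- β) * oneBot x
          ∎)
        where open ≡-Reasoning
      c₂≡0 : ∀ k → c₂ k ≡ 0ℚ
      c₂≡0 = ys-ind c₂ λ x → begin
        lincomb ys c₂ x                    ≡⟨ solve 1 (λ a → a := con 0ℚ :+ a) refl (lincomb ys c₂ x) ⟩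
        0ℚ + lincomb ys c₂ x               ≡⟨ cong (_+ lincomb ys c₂ x) (sym (lincomb-zero-coeffs xs c₁≡0 x)) ⟩
        lincomb xs c₁ x + lincomb ys c₂ x  ≡⟨ split x ⟩
        0ℚ                                 ∎
        where open ≡-Reasoning

module ForestRank where

  open import Defs
  open LinearAlgebra
  open import Algebra.Bundles using (CommutativeRing)
  open import Data.Nat as ℕ using (ℕ; suc)
  open import Data.Fin using (Fin; zero; suc; punchIn; cast)
  open import Data.Fin.Properties using (punchInᵢ≢i; cast-involutive) renaming (_≟_ to _≟ᶠ_)
  open import Data.Rational using (ℚ; 0ℚ; 1ℚ; _+_; _*_)
  open import Data.Rational.Properties using (+-*-commutativeRing; +-identityʳ)
  open import Data.Rational.Solver using (module +-*-Solver)
  open import Data.List using (List; []; _∷_; length; map; _++_)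
  open import Data.List.Properties using (length-++; length-map)
  open import Data.List.Relation.Unary.All as All using (All; []; _∷_)
  import Data.List.Relation.Unary.All.Properties as All
  open import Data.List.Relation.Unary.Any using (here; there)
  open import Data.List.Membership.Propositional using (_∈_)
  open import Data.Product using (_×_; _,_; proj₁; proj₂; ∃; ∃₂)
  open import Data.Sum using (_⊎_; inj₁; inj₂)
  open import Data.Unit using (⊤)
  open import Function using (_∘_)
  open import Relation.Binary.PropositionalEquality using (_≡_; _≢_; refl; sym; trans; cong; cong₂; subst; ≢-sym; module ≡-Reasoning)
  open import Relation.Nullary using (yes; no; contradiction)
  open import Algebra.Properties.Semiring.Sum (CommutativeRing.semiring +-*-commutativeRing)
    using (sum-syntax; sum-remove; sum-cong-≗; sum-replicate-zero)
  open +-*-Solver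

  δ-diag : ∀ {N} (i : Fin N) → δ i i ≡ 1ℚ
  δ-diag i with i ≟ᶠ i
  ... | yes _   = refl
  ... | no i≢i = contradiction refl i≢i

  δ-≢ : ∀ {N} {i k : Fin N} → i ≢ k → δ i k ≡ 0ℚ
  δ-≢ {i = i} {k} i≢k with i ≟ᶠ k
  ... | yes i≡k = contradiction i≡k i≢k
  ... | no _    = refl

  ∑-δ : ∀ {N} (i : Fin N) → ∑[ k < N ] δ i k ≡ 1ℚ
  ∑-δ {suc n} i = begin
    ∑[ k < suc n ] δ i k                  ≡⟨ sum-remove (δ i) ⟩
    δ i i + ∑[ k < n ] δ i (punchIn i k)  ≡⟨ cong₂ _+_ (δ-diag i) off-diagonal-sum ⟩
    1ℚ + 0ℚ                               ≡⟨ +-identityʳ 1ℚ ⟩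
    1ℚ                                    ∎
    where
    open ≡-Reasoning
    off-diagonal-sum : ∑[ k < n ] δ i (punchIn i k) ≡ 0ℚ
    off-diagonal-sum = trans (sum-cong-≗ λ k → δ-≢ (≢-sym (punchInᵢ≢i i k))) (sum-replicate-zero n)

  module _ {N : ℕ} where

    incidence : Fin N × Fin N → V N
    incidence (i , j) (inj₁ k) = δ i k
    incidence (i , j) (inj₂ k) = δ j k

    -- Each edge has a row or a column that no later edge meets: read backwards, the edges
    -- grow a forest of the row/column graph one leaf at a time.
    ForestOrder : List (Fin N × Fin N) → Set
    ForestOrder []            = ⊤
    ForestOrder ((i , j) ∷ F) = (All (λ f → proj₁ f ≢ i) F ⊎ All (λ f → proj₂ f ≢ j) F) × ForestOrder F

    MissesLine : List (Fin N × Fin N) → Set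
    MissesLine F = (∃ λ m → All (λ f → proj₁ f ≢ m) F) ⊎ (∃ λ m → All (λ f → proj₂ f ≢ m) F)

    incidence-vanishes-top : ∀ {m} F → All (λ f → proj₁ f ≢ m) F →
                             All (λ w → w (inj₁ m) ≡ 0ℚ) (map incidence F)
    incidence-vanishes-top F h = All.map⁺ (All.map δ-≢ h)

    incidence-vanishes-bot : ∀ {m} F → All (λ f → proj₂ f ≢ m) F →
                             All (λ w → w (inj₂ m) ≡ 0ℚ) (map incidence F)
    incidence-vanishes-bot F h = All.map⁺ (All.map δ-≢ h)

    forestOrder⇒echelon : ∀ F → ForestOrder F → Echelon (map incidence F)
    forestOrder⇒echelon []            _                     = _
    forestOrder⇒echelon ((i , j) ∷ F) (inj₁ row-free , ord) =
      (inj₁ i , δ-diag i , incidence-vanishes-top F row-free) , forestOrder⇒echelon F ord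
    forestOrder⇒echelon ((i , j) ∷ F) (inj₂ col-free , ord) =
      (inj₂ j , δ-diag j , incidence-vanishes-bot F col-free) , forestOrder⇒echelon F ord

    topSum botSum : V N → ℚ
    topSum v = ∑[ k < N ] v (inj₁ k)
    botSum v = ∑[ k < N ] v (inj₂ k)

    incidence-balanced : ∀ F c → topSum (lincomb (map incidence F) c) ≡ botSum (lincomb (map incidence F) c)
    incidence-balanced []            c = refl
    incidence-balanced ((i , j) ∷ F) c = begin
      ∑[ k < N ] (c zero * δ i k + L (inj₁ k))  ≡⟨ ∑-linear N (c zero) (δ i) (L ∘ inj₁) ⟩
      c zero * ∑[ k < N ] δ i k + topSum L     ≡⟨ cong₂ (λ a b → c zero * a + b) ∑δi≡∑δj (incidence-balanced F (c ∘ suc)) ⟩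
      c zero * ∑[ k < N ] δ j k + botSum L     ≡⟨ sym (∑-linear N (c zero) (δ j) (L ∘ inj₂)) ⟩
      ∑[ k < N ] (c zero * δ j k + L (inj₂ k))  ∎
      where
      open ≡-Reasoning
      L = lincomb (map incidence F) (c ∘ suc)
      ∑δi≡∑δj : ∑[ k < N ] δ i k ≡ ∑[ k < N ] δ j k
      ∑δi≡∑δj = trans (∑-δ i) (sym (∑-δ j))

    plane-top : ∀ α β (k : Fin N) → plane α β (inj₁ k) ≡ α
    plane-top α β k = solve 2 (λ a b → a :* con 1ℚ :+ b :* con 0ℚ := a) refl α β

    plane-bot : ∀ α β (k : Fin N) → plane α β (inj₂ k) ≡ β
    plane-bot α β k = solve 2 (λ a b → a :* con 0ℚ :+ b :* con 1ℚ := b) refl α β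

    plane-+ : ∀ α β α′ β′ (x : Fin N ⊎ Fin N) → plane α β x + plane α′ β′ x ≡ plane (α + α′) (β + β′) x
    plane-+ α β α′ β′ x =
      solve 6 (λ a b a′ b′ t w → (a :* t :+ b :* w) :+ (a′ :* t :+ b′ :* w) := (a :+ a′) :* t :+ (b :+ b′) :* w)
              refl α β α′ β′ (oneTop x) (oneBot x)

  plane-balanced : ∀ {N α β} → Fin N → topSum {N} (plane α β) ≡ botSum {N} (plane α β) → α ≡ β
  plane-balanced {suc n} {α} {β} _ eq = ∑-const-injective n (begin
    ∑[ k < suc n ] α              ≡⟨ sum-cong-≗ (sym ∘ plane-top {suc n} α β) ⟩
    topSum {suc n} (plane α β)    ≡⟨ eq ⟩
    botSum {suc n} (plane α β)    ≡⟨ sum-cong-≗ (plane-bot {suc n} α β) ⟩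
    ∑[ k < suc n ] β              ∎)
    where open ≡-Reasoning

  module _ {N : ℕ} where

    incidence-independentModPlane : ∀ (F : List (Fin N × Fin N)) → ForestOrder F → MissesLine F →
                                    IndependentModPlane (map incidence F)
    incidence-independentModPlane F ord miss c (α , β , L≈) = echelon⇒independent (forestOrder⇒echelon F ord) c L≈0
      where
      L = lincomb (map incidence F) c
      α≡β : Fin N → α ≡ β
      α≡β m = plane-balanced m (begin
        topSum {N} (plane α β)  ≡⟨ sum-cong-≗ (sym ∘ L≈ ∘ inj₁) ⟩
        topSum L                ≡⟨ incidence-balanced F c ⟩
        botSum L                ≡⟨ sum-cong-≗ (L≈ ∘ inj₂) ⟩
        botSum {N} (plane α β)  ∎)
        where open ≡-Reasoning
      α≡0×β≡0 : MissesLine F → α ≡ 0ℚ × β ≡ 0ℚ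
      α≡0×β≡0 (inj₁ (m , row-free)) = α≡0 , trans (sym (α≡β m)) α≡0
        where
        α≡0 : α ≡ 0ℚ
        α≡0 = trans (sym (trans (L≈ (inj₁ m)) (plane-top α β m)))
                    (lincomb-vanishes-at (map incidence F) c (inj₁ m) (incidence-vanishes-top F row-free))
      α≡0×β≡0 (inj₂ (m , col-free)) = trans (α≡β m) β≡0 , β≡0
        where
        β≡0 : β ≡ 0ℚ
        β≡0 = trans (sym (trans (L≈ (inj₂ m)) (plane-bot α β m)))
                    (lincomb-vanishes-at (map incidence F) c (inj₂ m) (incidence-vanishes-bot F col-free))
      L≈0 : L ≈v 0v
      L≈0 x rewrite L≈ x | proj₁ (α≡0×β≡0 miss) | proj₂ (α≡0×β≡0 miss) =
        solve 2 (λ t w → con 0ℚ :* t :+ con 0ℚ :* w := con 0ℚ) refl (oneTop x) (oneBot x)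

    incidence≈dvec+plane : ∀ (f : Fin N × Fin N) →
                           incidence f ≈v (dvec f +v plane (inD1 (proj₁ f) (proj₂ f)) (inD2 (proj₁ f) (proj₂ f)))
    incidence≈dvec+plane (i , j) (inj₁ k) =
      solve 3 (λ a p q → a := (a :- p) :+ (p :* con 1ℚ :+ q :* con 0ℚ)) refl (δ i k) (inD1 i j) (inD2 i j)
    incidence≈dvec+plane (i , j) (inj₂ k) =
      solve 3 (λ a p q → a := (a :- q) :+ (p :* con 0ℚ :+ q :* con 1ℚ)) refl (δ j k) (inD1 i j) (inD2 i j)

    length-map-incidence-dvec : ∀ (F : List (Fin N × Fin N)) → length (map incidence F) ≡ length (map dvec F)
    length-map-incidence-dvec F = trans (length-map incidence F) (sym (length-map dvec F))

    incidence-combination : ∀ F c → ∃₂ λ A B →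
      lincomb (map incidence F) (c ∘ cast (length-map-incidence-dvec F)) ≈v (lincomb (map dvec F) c +v plane A B)
    incidence-combination []      c = 0ℚ , 0ℚ , λ x →
      solve 2 (λ t w → con 0ℚ := con 0ℚ :+ (con 0ℚ :* t :+ con 0ℚ :* w)) refl (oneTop x) (oneBot x)
    incidence-combination (f ∷ F) c with incidence-combination F (c ∘ suc)
    ... | A , B , rest≈ = c zero * p + A , c zero * q + B , λ x → begin
      c zero * incidence f x + lincomb (map incidence F) (c ∘ suc ∘ cast (length-map-incidence-dvec F)) x
        ≡⟨ cong₂ (λ a b → c zero * a + b) (incidence≈dvec+plane f x) (rest≈ x) ⟩
      c zero * (dvec f x + plane p q x) + (lincomb (map dvec F) (c ∘ suc) x + plane A B x)
        ≡⟨ solve 9 (λ c₀ d p q L A B t w → c₀ :* (d :+ (p :* t :+ q :* w)) :+ (L :+ (A :* t :+ B :* w))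
                     := (c₀ :* d :+ L) :+ ((c₀ :* p :+ A) :* t :+ (c₀ :* q :+ B) :* w))
             refl (c zero) (dvec f x) p q (lincomb (map dvec F) (c ∘ suc) x) A B (oneTop x) (oneBot x) ⟩
      (c zero * dvec f x + lincomb (map dvec F) (c ∘ suc) x) + plane (c zero * p + A) (c zero * q + B) x
        ∎
      where
      open ≡-Reasoning
      p = inD1 (proj₁ f) (proj₂ f)
      q = inD2 (proj₁ f) (proj₂ f)

    dvec-independentModPlane : ∀ F → ForestOrder F → MissesLine F → IndependentModPlane (map dvec F)
    dvec-independentModPlane F ord miss c (α , β , dvecs≈) k with incidence-combination F c
    ... | A , B , incidences≈ = begin
      c k                        ≡⟨ cong c (sym (cast-involutive same-length (sym same-length) k)) ⟩
      c (cast same-length k′)    ≡⟨ incidence-independentModPlane F ord miss _ (α + A , β + B , in-plane) k′ ⟩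
      0ℚ                         ∎
      where
      open ≡-Reasoning
      same-length = length-map-incidence-dvec F
      k′ = cast (sym same-length) k
      in-plane : lincomb (map incidence F) (c ∘ cast same-length) ≈v plane (α + A) (β + B)
      in-plane x = trans (incidences≈ x) (trans (cong (_+ plane A B x) (dvecs≈ x)) (plane-+ α β A B x))

    dvec∈ColSpace : ∀ {J : List (Fin N × Fin N)} {f} → f ∈ J → ColSpace J (dvec f)
    dvec∈ColSpace {f ∷ J} (here refl) = (λ { zero → 1ℚ ; (suc _) → 0ℚ }) , λ x →
      trans (cong (1ℚ * dvec f x +_) (lincomb-zero-coeffs (map dvec J) (λ _ → refl) x))
            (solve 1 (λ a → con 1ℚ :* a :+ con 0ℚ := a) refl (dvec f x))
    dvec∈ColSpace {g ∷ J} (there f∈J) with dvec∈ColSpace f∈J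
    ... | c , J·c≈ = (λ { zero → 0ℚ ; (suc k) → c k }) , λ x →
      trans (solve 2 (λ a b → con 0ℚ :* a :+ b := b) refl (dvec g x) (lincomb (map dvec J) c x)) (J·c≈ x)

  record Forest {N} (J : List (Fin N × Fin N)) : Set where
    field
      edges       : List (Fin N × Fin N)
      edges⊆J     : All (_∈ J) edges
      forestOrder : ForestOrder edges
      missesLine  : MissesLine edges

  forest-rank-bound : ∀ {N} {J : List (Fin N × Fin N)} (F : Forest J) {r e} →
                      HasDim (ColSpace J) r → HasDim (EInter J) e → length (Forest.edges F) ℕ.+ e ℕ.≤ r
  forest-rank-bound {J = J} F {r} hr ((us , refl , us⊆E , us-independent) , _) =
    subst (ℕ._≤ r) length-columns (independent⇒length≤dim hr columns⊆ColSpace columns-independent)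
    where
    open Forest F
    columns⊆ColSpace : All (ColSpace J) (map dvec edges ++ us)
    columns⊆ColSpace = All.++⁺ (All.map⁺ (All.map dvec∈ColSpace edges⊆J)) (All.map proj₁ us⊆E)
    columns-independent : Independent (map dvec edges ++ us)
    columns-independent = ++-independent (map dvec edges) (dvec-independentModPlane edges forestOrder missesLine)
                                         (All.map (span2⇒inPlane ∘ proj₂) us⊆E) us-independent
    length-columns : length (map dvec edges ++ us) ≡ length edges ℕ.+ length us
    length-columns = trans (length-++ (map dvec edges)) (cong (ℕ._+ length us) (length-map dvec edges))

module Arithmetic where

  open import Defs using (ceilSqrtFrom; ceil2Sqrt)
  open import Data.Nat
  open import Data.Nat.Properties
  open import Data.Nat.Tactic.RingSolver using (solve-∀)
  open import Data.Product using (_,_)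
  open import Data.Sum using (inj₁; inj₂)
  open import Relation.Binary.PropositionalEquality using (_≡_; _≢_; refl; cong; subst; subst₂)
  open import Relation.Nullary using (yes; no; contradiction)

  ceilSqrtFrom-≤ : ∀ fuel k n k′ → k ≤ k′ → n ≤ k′ * k′ → ceilSqrtFrom fuel k n ≤ k′
  ceilSqrtFrom-≤ zero       k n k′ k≤k′ _ = k≤k′
  ceilSqrtFrom-≤ (suc fuel) k n k′ k≤k′ n≤k′² with n ≤? k * k
  ... | yes _ = k≤k′
  ... | no n≰k² with m≤n⇒m<n∨m≡n k≤k′
  ...   | inj₁ k<k′ = ceilSqrtFrom-≤ fuel (suc k) n k′ k<k′ n≤k′²
  ...   | inj₂ refl = contradiction n≤k′² n≰k²

  ceil2Sqrt-≤ : ∀ n k → 4 * n ≤ k * k → ceil2Sqrt n ≤ k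
  ceil2Sqrt-≤ n k = ceilSqrtFrom-≤ (suc (4 * n)) 0 (4 * n) k z≤n

  am-gm-≤ : ∀ {x y} → x ≤ y → 4 * (x * y) ≤ (x + y) * (x + y)
  am-gm-≤ {x} x≤y with m≤n⇒∃[o]m+o≡n x≤y
  ... | k , refl = ≤-trans (m≤m+n (4 * (x * (x + k))) (k * k)) (≤-reflexive (square-expand x k))
    where
    square-expand : ∀ x k → 4 * (x * (x + k)) + k * k ≡ (x + (x + k)) * (x + (x + k))
    square-expand = solve-∀

  am-gm : ∀ x y → 4 * (x * y) ≤ (x + y) * (x + y)
  am-gm x y with ≤-total x y
  ... | inj₁ x≤y = am-gm-≤ x≤y
  ... | inj₂ y≤x = subst₂ (λ a b → 4 * a ≤ b * b) (*-comm y x) (+-comm y x) (am-gm-≤ y≤x)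

  -- The ways in which a forest with s edges in a grid of side N = M + 1 gives the bound for
  -- |J| = n: ⌈2√n⌉ ≤ s + 1, or s ≥ 2N - 2, or n = (N - 1)² + 1 and s ≥ 2N - 3.
  data Sufficient (n M s : ℕ) : Set where
    square      : 4 * n ≤ suc s * suc s → Sufficient n M s
    saturated   : 2 * M ≤ s → Sufficient n M s
    exceptional : n ≡ suc (M * M) → 2 * M ≤ suc s → Sufficient n M s

  area-bound : ∀ {n R d} → n ≤ suc R * d → 4 * n ≤ suc (R + d) * suc (R + d)
  area-bound {R = R} {d} n≤ = ≤-trans (*-monoʳ-≤ 4 n≤) (am-gm (suc R) d)

  saturated-bound : ∀ {R M d} → suc R ≡ M → suc M ≤ d → 2 * M ≤ R + d
  saturated-bound {R} refl M<d = ≤-trans (≤-reflexive (expand R)) (+-monoʳ-≤ R M<d)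
    where
    expand : ∀ R → 2 * suc R ≡ R + suc (suc R)
    expand = solve-∀

  pinned-bound-full : ∀ {n R} → n ≤ suc R + suc (R * suc R) → Sufficient n (suc R) (R + suc R)
  pinned-bound-full {n} {R} n≤ with n ≟ suc (suc R * suc R)
  ... | yes n≡ = exceptional n≡ (≤-reflexive (double R))
    where
    double : ∀ R → 2 * suc R ≡ suc (R + suc R)
    double = solve-∀
  ... | no n≢ = square (≤-trans (*-monoʳ-≤ 4 n≤R²) (≤-reflexive (quadruple R)))
    where
    full : ∀ R → suc R + suc (R * suc R) ≡ suc (suc R * suc R)
    full = solve-∀
    n≤R² : n ≤ suc R * suc R
    n≤R² = ≤-pred (≤∧≢⇒< (≤-trans n≤ (≤-reflexive (full R))) n≢)
    quadruple : ∀ R → 4 * (suc R * suc R) ≡ suc (R + suc R) * suc (R + suc R)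
    quadruple = solve-∀

  -- With M = d + 2 + k, the slack (M + d)² - 4 (1 + d M) = (M - d)² - 4 is k² + 4k.
  pinned-bound-sparse : ∀ {n d k} → n ≤ d + suc (suc (d + k) * d) →
                        4 * n ≤ suc (suc (d + k) + d) * suc (suc (d + k) + d)
  pinned-bound-sparse {n} {d} {k} n≤ =
    ≤-trans (*-monoʳ-≤ 4 n≤) (≤-trans (m≤m+n _ (k * k + 4 * k)) (≤-reflexive (expand d k)))
    where
    expand : ∀ d k → 4 * (d + suc (suc (d + k) * d)) + (k * k + 4 * k) ≡ suc (suc (d + k) + d) * suc (suc (d + k) + d)
    expand = solve-∀

  pinned-bound : ∀ {n R M d} → suc R ≡ M → d ≤ M → suc d ≢ M → n ≤ d + suc (R * d) → Sufficient n M (R + d)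
  pinned-bound refl d≤M 1+d≢M n≤ with m≤n⇒m<n∨m≡n d≤M
  ... | inj₂ refl = pinned-bound-full n≤
  ... | inj₁ d<M with m≤n⇒m<n∨m≡n d<M
  ...   | inj₂ 1+d≡M = contradiction 1+d≡M 1+d≢M
  ...   | inj₁ 2+d≤M with m≤n⇒∃[o]m+o≡n 2+d≤M
  ...     | _ , refl = square (pinned-bound-sparse n≤)

  doubly-pinned-bound : ∀ {n R′ d} → suc R′ ≡ d → 2 ≤ d → n ≤ d + suc (suc (R′ * d)) →
                        4 * n ≤ suc (suc R′ + d) * suc (suc R′ + d)
  doubly-pinned-bound {R′ = suc t} refl (s≤s (s≤s z≤n)) n≤ =
    ≤-trans (*-monoʳ-≤ 4 n≤) (≤-trans (m≤m+n _ (4 * t + 1)) (≤-reflexive (expand t)))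
    where
    expand : ∀ t → 4 * (suc (suc t) + suc (suc (suc t * suc (suc t)))) + (4 * t + 1)
                 ≡ suc (suc (suc t) + suc (suc t)) * suc (suc (suc t) + suc (suc t))
    expand = solve-∀

  square-exceeds : ∀ {M s} → 4 * suc (M * M) ≤ suc s * suc s → 2 * M ≤ s
  square-exceeds {M} {s} big with 2 * M ≤? s
  ... | yes 2M≤s = 2M≤s
  ... | no 2M≰s = contradiction big (<⇒≱ (begin-strict
    suc s * suc s      ≤⟨ *-mono-≤ s<2M s<2M ⟩
    2 * M * (2 * M)    ≡⟨ quadruple M ⟩
    4 * (M * M)        <⟨ *-monoʳ-< 4 (n<1+n (M * M)) ⟩
    4 * suc (M * M)    ∎))
    where
    open ≤-Reasoning
    s<2M : suc s ≤ 2 * M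
    s<2M = ≰⇒> 2M≰s
    quadruple : ∀ M → 2 * M * (2 * M) ≡ 4 * (M * M)
    quadruple = solve-∀

  double-suc : ∀ M → 2 * suc M ≡ 2 + 2 * M
  double-suc = solve-∀

  sufficient⇒generic : ∀ {n M s} → Sufficient n M s → n ≢ suc (M * M) → ceil2Sqrt n ⊓ (2 * suc M ∸ 1) ≤ suc s
  sufficient⇒generic {n} {M} {s} (square h)        _  = ≤-trans (m⊓n≤m _ _) (ceil2Sqrt-≤ n (suc s) h)
  sufficient⇒generic {n} {M} {s} (saturated h)     _  =
    ≤-trans (m⊓n≤n _ _) (≤-trans (≤-reflexive (cong (_∸ 1) (double-suc M))) (s≤s h))
  sufficient⇒generic               (exceptional n≡ _) n≢ = contradiction n≡ n≢

  sufficient⇒exceptional : ∀ {n M s} → Sufficient n M s → n ≡ suc (M * M) → 2 * suc M ∸ 3 ≤ s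
  sufficient⇒exceptional {n} {M} {s} suff n≡ = ≤-trans (≤-reflexive (cong (_∸ 3) (double-suc M))) (2M-1≤s suff)
    where
    2M-1≤s : Sufficient n M s → 2 * M ∸ 1 ≤ s
    2M-1≤s (square h)        = ≤-trans (m∸n≤m _ 1) (square-exceeds {M} (subst (λ x → 4 * x ≤ suc s * suc s) n≡ h))
    2M-1≤s (saturated h)     = ≤-trans (m∸n≤m _ 1) h
    2M-1≤s (exceptional _ h) = ∸-monoˡ-≤ 1 h

module Brooms where

  open ListCounting
  open ForestRank using (Forest; ForestOrder; MissesLine)
  open Arithmetic

  open import Data.Nat using (ℕ; suc; _+_; _*_; _≤_; _<_; z≤n; s≤s)
  open import Data.Nat.Properties
    using (≤-trans; ≤-reflexive; ≤-pred; +-mono-≤; +-monoʳ-≤; n≢0⇒n>0; suc-injective; <⇒≢; n≮n) renaming (_≟_ to _≟ℕ_)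
  open import Data.Nat.ListAction using (sum)
  open import Data.Fin using (Fin; zero; suc)
  open import Data.Fin.Properties using (_≟_; all?; any?; ¬∀⟶∃¬)
  open import Data.Product using (_×_; _,_; proj₁; proj₂; ∃; Σ; uncurry)
  open import Data.List.Extrema.Nat using (argmax; f[xs]≤f[argmax])
  open import Data.Product.Properties using (≡-dec)
  open import Data.Sum using (inj₁; inj₂)
  open import Data.List using (List; []; _∷_; length; map; filter; allFin; concatMap; _++_)
  open import Data.List.Properties using (length-++; length-map; map-cong; length-tabulate)
  open import Data.List.Relation.Unary.All as All using (All; []; _∷_)
  import Data.List.Relation.Unary.All.Properties as All
  open import Data.List.Relation.Unary.Any using (Any; here; there)
  open import Data.List.Membership.Propositional using (_∈_; _∉_; lose; find)
  open import Data.List.Membership.Propositional.Properties using (∈-filter⁺; ∈-filter⁻; ∈-allFin; ∈-map⁺; ∈-concatMap⁺; ∈-length)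
  import Data.List.Membership.DecPropositional as DecMembership
  open import Data.List.Relation.Unary.Unique.Propositional using (Unique; []; _∷_)
  import Data.List.Relation.Unary.Unique.Propositional.Properties as Unique
  open import Function using (_∘_; id)
  open import Relation.Binary.PropositionalEquality using (_≡_; _≢_; refl; sym; trans; cong; cong₂; subst; ≢-sym)
  open import Relation.Nullary using (¬_; ¬?; Dec; yes; no; contradiction)
  open import Relation.Nullary.Decidable using (_×-dec_)

  star-forestOrder : ∀ {N} (i₀ : Fin N) {cs} → Unique cs → ForestOrder (map (i₀ ,_) cs)
  star-forestOrder i₀ []              = _
  star-forestOrder i₀ (j∉cs ∷ unique) = inj₂ (All.map⁺ (All.map ≢-sym j∉cs)) , star-forestOrder i₀ unique

  length-allFin-without : ∀ {n} (x : Fin (suc n)) → length (without _≟_ x (allFin (suc n))) ≡ n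
  length-allFin-without {n} x =
    suc-injective (trans (sym (length-without _≟_ (Unique.allFin⁺ (suc n)) (∈-allFin x))) (length-tabulate id))

  module _ {N : ℕ} (J : List (Fin N × Fin N)) where

    ∈J? : ∀ i j → Dec ((i , j) ∈ J)
    ∈J? i j = DecMembership._∈?_ (≡-dec _≟_ _≟_) (i , j) J

    columns : Fin N → List (Fin N)
    columns i = filter (∈J? i) (allFin N)

    deg : Fin N → ℕ
    deg i = length (columns i)

    ∈-columns⁺ : ∀ {i j} → (i , j) ∈ J → j ∈ columns i
    ∈-columns⁺ {i} {j} = ∈-filter⁺ (∈J? i) (∈-allFin j)

    ∈-columns⁻ : ∀ {i j} → j ∈ columns i → (i , j) ∈ J
    ∈-columns⁻ {i} = proj₂ ∘ ∈-filter⁻ (∈J? i) {xs = allFin N}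

    columns-unique : ∀ i → Unique (columns i)
    columns-unique i = Unique.filter⁺ (∈J? i) (Unique.allFin⁺ N)

    length≤∑deg : Unique J → length J ≤ sum (map deg (allFin N))
    length≤∑deg J-unique = ≤-trans (Unique⇒length-≤ (≡-dec _≟_ _≟_) J-unique J⊆rows) (≤-reflexive length-rows)
      where
      row : Fin N → List (Fin N × Fin N)
      row i = map (i ,_) (columns i)
      J⊆rows : ∀ {f} → f ∈ J → f ∈ concatMap row (allFin N)
      J⊆rows {i , j} f∈J = ∈-concatMap⁺ row (lose (∈-allFin i) (∈-map⁺ (i ,_) (∈-columns⁺ f∈J)))
      length-rows : length (concatMap row (allFin N)) ≡ sum (map deg (allFin N))
      length-rows = trans (length-concatMap row (allFin N))
                          (cong sum (map-cong (λ i → length-map (i ,_) (columns i)) (allFin N)))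

    broom : Fin N → (Fin N → Fin N) → List (Fin N) → List (Fin N × Fin N)
    broom i₀ p rows = map (λ i → i , p i) rows ++ map (i₀ ,_) (columns i₀)

    length-broom : ∀ i₀ p rows → length (broom i₀ p rows) ≡ length rows + deg i₀
    length-broom i₀ p rows = trans (length-++ (map (λ i → i , p i) rows))
                                   (cong₂ _+_ (length-map (λ i → i , p i) rows) (length-map (i₀ ,_) (columns i₀)))

    broom⊆J : ∀ i₀ p {rows} → All (λ i → (i , p i) ∈ J) rows → All (_∈ J) (broom i₀ p rows)
    broom⊆J i₀ p handles = All.++⁺ (All.map⁺ handles) (All.map⁺ (All.tabulate ∈-columns⁻))

    broom-forestOrder : ∀ i₀ p {rows} → Unique rows → All (_≢ i₀) rows → ForestOrder (broom i₀ p rows)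
    broom-forestOrder i₀ p []                    []              = star-forestOrder i₀ (columns-unique i₀)
    broom-forestOrder i₀ p (r∉rows ∷ unique) (r≢i₀ ∷ rows≢i₀) =
      inj₁ (All.++⁺ (All.map⁺ (All.map ≢-sym r∉rows)) (All.map⁺ (All.tabulate λ _ → ≢-sym r≢i₀)))
      , broom-forestOrder i₀ p unique rows≢i₀

    broom-misses-row : ∀ i₀ p {rows} m → All (_≢ m) rows → (∀ {j} → j ∈ columns i₀ → i₀ ≢ m) → MissesLine (broom i₀ p rows)
    broom-misses-row i₀ p m rows≢m star≢m = inj₁ (m , All.++⁺ (All.map⁺ rows≢m) (All.map⁺ (All.tabulate star≢m)))

    broom-misses-column : ∀ i₀ p {rows} c → All (λ i → p i ≢ c) rows → c ∉ columns i₀ → MissesLine (broom i₀ p rows)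
    broom-misses-column i₀ p c handles≢c c∉star =
      inj₂ (c , All.++⁺ (All.map⁺ handles≢c) (All.map⁺ (All.tabulate λ j∈ j≡c → c∉star (subst (_∈ columns i₀) j≡c j∈))))

  module LargeForest {M : ℕ} (3≤M : 3 ≤ M) (J : List (Fin (suc M) × Fin (suc M))) (J-unique : Unique J) where

    open DecMembership (_≟_ {suc M}) using (_∈?_)

    SufficientForest : Set
    SufficientForest = Σ (Forest J) λ F → Sufficient (length J) M (length (Forest.edges F))

    -- Opaque: unfolding the argmax makes unification against d very slow.
    opaque
      i₀ : Fin (suc M)
      i₀ = argmax (deg J) zero (allFin (suc M))

      deg≤deg-i₀ : ∀ i → deg J i ≤ deg J i₀
      deg≤deg-i₀ i = All.lookup (f[xs]≤f[argmax] {f = deg J} zero (allFin (suc M))) (∈-allFin i)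

    d : ℕ
    d = deg J i₀

    sum-deg≤ : ∀ xs → sum (map (deg J) xs) ≤ length xs * d
    sum-deg≤ xs = sum-map-≤ (deg J) (All.tabulate {xs = xs} λ {i} _ → deg≤deg-i₀ i)

    others : List (Fin (suc M))
    others = without _≟_ i₀ (allFin (suc M))

    others-unique : Unique others
    others-unique = without-unique _≟_ i₀ (Unique.allFin⁺ (suc M))

    others≢i₀ : ∀ {i} → i ∈ others → i ≢ i₀
    others≢i₀ i∈ = proj₂ (∈-without⁻ _≟_ (allFin (suc M)) i∈)

    length-others : length others ≡ M
    length-others = length-allFin-without i₀

    length≤d+others : length J ≤ d + sum (map (deg J) others)
    length≤d+others = ≤-trans (length≤∑deg J J-unique)
                              (≤-reflexive (sum-map-without _≟_ (deg J) (Unique.allFin⁺ (suc M)) (∈-allFin i₀)))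

    via-broom : ∀ p rows → Unique rows → (∀ {i} → i ∈ rows → i ≢ i₀) → (∀ {i} → i ∈ rows → (i , p i) ∈ J) →
               MissesLine (broom J i₀ p rows) → Sufficient (length J) M (length rows + d) → SufficientForest
    via-broom p rows unique rows≢i₀ handles misses sufficient =
      record { edges       = broom J i₀ p rows
             ; edges⊆J     = broom⊆J J i₀ p (All.tabulate handles)
             ; forestOrder = broom-forestOrder J i₀ p unique (All.tabulate rows≢i₀)
             ; missesLine  = misses }
      , subst (Sufficient (length J) M) (sym (length-broom J i₀ p rows)) sufficient

    firstColumn : Fin (suc M) → Fin (suc M)
    firstColumn i = firstOr i (columns J i)

    firstColumn∈J : ∀ {i} → deg J i ≢ 0 → (i , firstColumn i) ∈ J
    firstColumn∈J nonempty = ∈-columns⁻ J (firstOr-∈ _ (n≢0⇒n>0 nonempty))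

    via-empty-row : ∀ z → deg J z ≡ 0 → SufficientForest
    via-empty-row z deg-z≡0 =
      via-broom firstColumn rows (Unique.filter⁺ (nonzero? (deg J)) others-unique) (others≢i₀ ∘ proj₁ ∘ ∈-rows⁻)
        (firstColumn∈J ∘ proj₂ ∘ ∈-rows⁻) (broom-misses-row J i₀ firstColumn z (All.tabulate rows≢z) i₀≢z)
        (square (area-bound {R = length rows} {d = d} count))
      where
      rows : List (Fin (suc M))
      rows = support (deg J) others
      ∈-rows⁻ : ∀ {i} → i ∈ rows → i ∈ others × deg J i ≢ 0
      ∈-rows⁻ = ∈-filter⁻ (nonzero? (deg J)) {xs = others}
      rows≢z : ∀ {i} → i ∈ rows → i ≢ z
      rows≢z i∈ refl = proj₂ (∈-rows⁻ i∈) deg-z≡0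
      i₀≢z : ∀ {j} → j ∈ columns J i₀ → i₀ ≢ z
      i₀≢z j∈ refl = <⇒≢ (∈-length j∈) (sym deg-z≡0)
      count : length J ≤ suc (length rows) * d
      count = ≤-trans length≤d+others (+-monoʳ-≤ d (≤-trans (≤-reflexive (sym (sum-map-support (deg J) others)))
                                                            (sum-deg≤ rows)))

    module WithoutRow (nonempty : ∀ i → deg J i ≢ 0) (r : Fin (suc M)) (r≢i₀ : r ≢ i₀) where

      rows : List (Fin (suc M))
      rows = without _≟_ r others

      r∈others : r ∈ others
      r∈others = ∈-without⁺ _≟_ (∈-allFin r) r≢i₀

      rows-unique : Unique rows
      rows-unique = without-unique _≟_ r others-unique

      suc-length-rows : suc (length rows) ≡ M
      suc-length-rows = trans (sym (length-without _≟_ others-unique r∈others)) length-others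

      length≤d+r+rows : length J ≤ d + (deg J r + sum (map (deg J) rows))
      length≤d+r+rows = ≤-trans length≤d+others (≤-reflexive (cong (d +_) (sum-map-without _≟_ (deg J) others-unique r∈others)))

      result : Sufficient (length J) M (length rows + d) → SufficientForest
      result = via-broom firstColumn rows rows-unique (others≢i₀ ∘ proj₁ ∘ ∈-rows⁻) (λ {i} _ → firstColumn∈J (nonempty i))
                 (broom-misses-row J i₀ firstColumn r (All.tabulate (proj₂ ∘ ∈-rows⁻)) (λ _ → ≢-sym r≢i₀))
        where
        ∈-rows⁻ : ∀ {i} → i ∈ rows → i ∈ others × i ≢ r
        ∈-rows⁻ = ∈-without⁻ _≟_ others

    via-full-row : (∀ i → deg J i ≢ 0) → (∀ j → j ∈ columns J i₀) → SufficientForest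
    via-full-row nonempty full = result (saturated (saturated-bound suc-length-rows N≤d))
      where
      r₀ : Fin (suc M)
      r₀ = firstOr i₀ others
      r₀∈others : r₀ ∈ others
      r₀∈others = firstOr-∈ i₀ (subst (0 <_) (sym length-others) (≤-trans (s≤s z≤n) 3≤M))
      open WithoutRow nonempty r₀ (others≢i₀ r₀∈others)
      N≤d : suc M ≤ d
      N≤d = subst (_≤ d) (length-tabulate id) (Unique⇒length-≤ _≟_ (Unique.allFin⁺ (suc M)) (λ {j} _ → full j))

    via-avoidable-column : ∀ c → c ∉ columns J i₀ → (∀ i → i ≢ i₀ → Any (_≢ c) (columns J i)) → SufficientForest
    via-avoidable-column c c∉ avoidable =
      via-broom p others others-unique others≢i₀ (∈-columns⁻ J ∘ proj₁ ∘ p-spec)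
        (broom-misses-column J i₀ p c (All.tabulate (proj₂ ∘ p-spec)) c∉)
        (square (area-bound {R = length others} {d = d} count))
      where
      p : Fin (suc M) → Fin (suc M)
      p i = firstOr i (without _≟_ c (columns J i))
      p-spec : ∀ {i} → i ∈ others → p i ∈ columns J i × p i ≢ c
      p-spec {i} i∈ with find (avoidable i (others≢i₀ i∈))
      ... | j , j∈ , j≢c = ∈-without⁻ _≟_ (columns J i) (firstOr-∈ i (∈-length (∈-without⁺ _≟_ j∈ j≢c)))
      count : length J ≤ suc (length others) * d
      count = ≤-trans length≤d+others (+-monoʳ-≤ d (sum-deg≤ others))

    -- No broom through row r can avoid column c.
    Pinned : Fin (suc M) → Fin (suc M) → Set
    Pinned c r = r ≢ i₀ × All (_≡ c) (columns J r)

    pinned? : ∀ c r → Dec (Pinned c r)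
    pinned? c r = ¬? (r ≟ i₀) ×-dec All.all? (_≟ c) (columns J r)

    unpinned⇒avoidable : ∀ c → ¬ ∃ (Pinned c) → ∀ i → i ≢ i₀ → Any (_≢ c) (columns J i)
    unpinned⇒avoidable c unpinned i i≢i₀ = All.¬All⇒Any¬ (_≟ c) (columns J i) (λ i⊆c → unpinned (i , i≢i₀ , i⊆c))

    deg-pinned : ∀ {c r} → Pinned c r → deg J r ≤ 1
    deg-pinned {c} {r} (_ , r⊆c) = Unique⇒length-≤ _≟_ {ys = c ∷ []} (columns-unique J r) (λ j∈ → here (All.lookup r⊆c j∈))

    d≤M : ∀ {c} → c ∉ columns J i₀ → d ≤ M
    d≤M {c} c∉ = ≤-trans (Unique⇒length-≤ _≟_ (columns-unique J i₀) i₀⊆others) (≤-reflexive (length-allFin-without c))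
      where
      i₀⊆others : ∀ {j} → j ∈ columns J i₀ → j ∈ without _≟_ c (allFin (suc M))
      i₀⊆others {j} j∈ = ∈-without⁺ _≟_ (∈-allFin j) (λ j≡c → c∉ (subst (_∈ columns J i₀) j≡c j∈))

    second-missing-column : suc d ≡ M → ∀ c → ∃ λ c₂ → c₂ ∉ c ∷ columns J i₀
    second-missing-column 1+d≡M c with all? (λ j → j ∈? (c ∷ columns J i₀))
    ... | yes all-in = contradiction (subst (_≤ d) (sym 1+d≡M) M≤d) (n≮n d)
      where
      N≤1+d : length (allFin (suc M)) ≤ suc d
      N≤1+d = Unique⇒length-≤ _≟_ (Unique.allFin⁺ (suc M)) (λ {j} _ → all-in j)
      M≤d : M ≤ d
      M≤d = ≤-pred (subst (_≤ suc d) (length-tabulate id) N≤1+d)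
    ... | no ¬all-in = ¬∀⟶∃¬ (suc M) _ (λ j → j ∈? (c ∷ columns J i₀)) ¬all-in

    via-pinned-row : (∀ i → deg J i ≢ 0) → ∀ c r₁ → Pinned c r₁ → d ≤ M → suc d ≢ M → SufficientForest
    via-pinned-row nonempty c r₁ pinned₁ d≤M 1+d≢M = result (pinned-bound suc-length-rows d≤M 1+d≢M count)
      where
      open WithoutRow nonempty r₁ (proj₁ pinned₁)
      count : length J ≤ d + suc (length rows * d)
      count = ≤-trans length≤d+r+rows
        (+-monoʳ-≤ d (+-mono-≤ (deg-pinned pinned₁) (sum-deg≤ rows)))

    via-two-pinned-rows : (∀ i → deg J i ≢ 0) → ∀ c₁ c₂ → c₂ ≢ c₁ → ∀ r₁ r₂ → Pinned c₁ r₁ → Pinned c₂ r₂ →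
                          suc d ≡ M → SufficientForest
    via-two-pinned-rows nonempty c₁ c₂ c₂≢c₁ r₁ r₂ pinned₁ pinned₂ 1+d≡M =
      result (square (subst (λ R → 4 * length J ≤ suc (R + d) * suc (R + d)) (sym length-rows)
                            (doubly-pinned-bound suc-length-rest 2≤d count)))
      where
      open WithoutRow nonempty r₁ (proj₁ pinned₁)
      r₂≢r₁ : r₂ ≢ r₁
      r₂≢r₁ refl = c₂≢c₁ (trans (sym (All.lookup (proj₂ pinned₂) j∈)) (All.lookup (proj₂ pinned₁) j∈))
        where
        j∈ : firstOr r₁ (columns J r₁) ∈ columns J r₁
        j∈ = firstOr-∈ r₁ (n≢0⇒n>0 (nonempty r₁))
      r₂∈rows : r₂ ∈ rows
      r₂∈rows = ∈-without⁺ _≟_ (∈-without⁺ _≟_ (∈-allFin r₂) (proj₁ pinned₂)) r₂≢r₁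
      rest : List (Fin (suc M))
      rest = without _≟_ r₂ rows
      length-rows : length rows ≡ suc (length rest)
      length-rows = length-without _≟_ rows-unique r₂∈rows
      suc-length-rest : suc (length rest) ≡ d
      suc-length-rest = suc-injective (trans (cong suc (sym length-rows)) (trans suc-length-rows (sym 1+d≡M)))
      2≤d : 2 ≤ d
      2≤d = ≤-pred (subst (3 ≤_) (sym 1+d≡M) 3≤M)
      count : length J ≤ d + suc (suc (length rest * d))
      count = ≤-trans length≤d+r+rows (+-monoʳ-≤ d (+-mono-≤ (deg-pinned pinned₁)
        (≤-trans (≤-reflexive (sum-map-without _≟_ (deg J) rows-unique r₂∈rows))
                 (+-mono-≤ (deg-pinned pinned₂) (sum-deg≤ rest)))))

    -- For d = M - 1, dropping one pinned row is one short of the bound; a second column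
    -- missing from row i₀ is then either avoidable or pins a second row, sharpening the count.
    via-missing-column : (∀ i → deg J i ≢ 0) → ∀ c → c ∉ columns J i₀ → SufficientForest
    via-missing-column nonempty c c∉ with any? (pinned? c)
    ... | no unpinned = via-avoidable-column c c∉ (unpinned⇒avoidable c unpinned)
    ... | yes (r₁ , pinned₁) with suc d ≟ℕ M
    ...   | no 1+d≢M = via-pinned-row nonempty c r₁ pinned₁ (d≤M c∉) 1+d≢M
    ...   | yes 1+d≡M with second-missing-column 1+d≡M c
    ...     | c₂ , c₂∉ with any? (pinned? c₂)
    ...       | no unpinned₂ = via-avoidable-column c₂ (c₂∉ ∘ there) (unpinned⇒avoidable c₂ unpinned₂)
    ...       | yes (r₂ , pinned₂) = via-two-pinned-rows nonempty c c₂ (c₂∉ ∘ here) r₁ r₂ pinned₁ pinned₂ 1+d≡M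

    via-nonempty-rows : (∀ i → deg J i ≢ 0) → SufficientForest
    via-nonempty-rows nonempty with all? (_∈? columns J i₀)
    ... | yes full = via-full-row nonempty full
    ... | no ¬full = uncurry (via-missing-column nonempty) (¬∀⟶∃¬ (suc M) _ (_∈? columns J i₀) ¬full)

    large-forest : SufficientForest
    large-forest with any? (λ i → deg J i ≟ℕ 0)
    ... | yes (z , deg-z≡0) = via-empty-row z deg-z≡0
    ... | no no-empty-row   = via-nonempty-rows (λ i → no-empty-row ∘ (i ,_))

open import Defs
open import Data.Nat using (ℕ; suc; _+_; _*_; _∸_; _≤_; _⊓_)
open import Data.Fin using (Fin)
open import Data.Product using (_×_)
open import Data.List using (List; length)
open import Data.List.Relation.Unary.Unique.Propositional using (Unique)
open import Relation.Binary.PropositionalEquality using (_≡_)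
open import Relation.Nullary using (¬_)
open import Data.Nat using (s≤s)
open import Data.Nat.Properties using (≤-trans; +-monoˡ-≤)
open import Data.Product using (_,_)
open ForestRank using (Forest; forest-rank-bound)
open Arithmetic using (sufficient⇒generic; sufficient⇒exceptional)
open Brooms using (module LargeForest)

lemma6 : (N : ℕ) → 4 ≤ N → (J : List (Fin N × Fin N)) → Unique J →
         (r e : ℕ) → HasDim (ColSpace J) r → HasDim (EInter J) e →
         (¬ (length J ≡ suc ((N ∸ 1) * (N ∸ 1))) →
            (ceil2Sqrt (length J) ⊓ (2 * N ∸ 1)) + e ≤ suc r) ×
         (length J ≡ suc ((N ∸ 1) * (N ∸ 1)) →
            (2 * N ∸ 3) + e ≤ r)
lemma6 (suc M) (s≤s 3≤M) J J-unique r e hr he with LargeForest.large-forest 3≤M J J-unique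
... | F , sufficient = generic , exceptional-size
  where
  s+e≤r : length (Forest.edges F) + e ≤ r
  s+e≤r = forest-rank-bound F hr he
  generic : ¬ (length J ≡ suc (M * M)) → ceil2Sqrt (length J) ⊓ (2 * suc M ∸ 1) + e ≤ suc r
  generic n≢ = ≤-trans (+-monoˡ-≤ e (sufficient⇒generic sufficient n≢)) (s≤s s+e≤r)
  exceptional-size : length J ≡ suc (M * M) → 2 * suc M ∸ 3 + e ≤ r
  exceptional-size n≡ = ≤-trans (+-monoˡ-≤ e (sufficient⇒exceptional sufficient n≡)) s+e≤r
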